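{- For every positive integer $m$, the line graph $L(K_{2m+1})$ of the complete graph on $2m+1$ vertices is a core, i.e. every endomorphism of $L(K_{2m+1})$ is an automorphism.
   Context: An endomorphism of a graph $X$ is a map $V(X)\to V(X)$ sending adjacent vertices to adjacent vertices; $X$ is a core if all its endomorphisms are automorphisms. -}

module Defs where

open import Level using (Level; _⊔_; suc)
open import Data.Nat using (ℕ; _+_; _*_)
open import Data.Fin using (Fin; _<_)
open import Data.Product using (Σ; _×_; _,_; proj₁; proj₂; ∃)
open import Data.Sum using (_⊎_)
open import Relation.Binary.PropositionalEquality using (_≡_; _≢_)
open import Function using (_∘_)

record Graph (a ℓ : Level) : Set (suc (a ⊔ ℓ)) where
  field
    V   : Set a
    Adj : V → V → Set ℓ

open Graph public

IsEndomorphism : ∀ {a ℓ} (X : Graph a ℓ) → (V X → V X) → Set (a ⊔ ℓ)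
IsEndomorphism X f = ∀ {x y} → Adj X x y → Adj X (f x) (f y)

IsAutomorphism : ∀ {a ℓ} (X : Graph a ℓ) → (V X → V X) → Set (a ⊔ ℓ)
IsAutomorphism X f =
  Σ (V X → V X) λ g →
    (∀ x → g (f x) ≡ x) × (∀ x → f (g x) ≡ x) ×
    IsEndomorphism X f × IsEndomorphism X g

IsCore : ∀ {a ℓ} (X : Graph a ℓ) → Set (a ⊔ ℓ)
IsCore X = ∀ (f : V X → V X) → IsEndomorphism X f → IsAutomorphism X f

-- Vertices of the line graph L(K_n): the edges of K_n, i.e. 2-element subsets
-- {i , j} of Fin n, represented canonically as pairs (i , j) with i < j.
Edge : ℕ → Set
Edge n = Σ (Fin n × Fin n) λ p → proj₁ p < proj₂ p

ShareEndpoint : ∀ {n} → Edge n → Edge n → Set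
ShareEndpoint ((i , j) , _) ((k , l) , _) =
  (i ≡ k) ⊎ (i ≡ l) ⊎ (j ≡ k) ⊎ (j ≡ l)

LineGraphOfComplete : ℕ → Graph Level.zero Level.zero
LineGraphOfComplete n = record
  { V   = Edge n
  ; Adj = λ e e′ → (e ≢ e′) × ShareEndpoint e e′
  }

{-# OPTIONS --safe #-}
module Submission where

-- An endomorphism f of L(K_n) maps the star of edges at a vertex v, a clique,
-- to pairwise intersecting edges.  Four pairwise intersecting edges always pass
-- through one vertex (three edges without a common vertex form a triangle, and
-- no fourth edge meets all three sides), so for n ≠ 4 the common vertex σ v of
-- the images of two edges at v lies on the image of every edge at v; hence
-- f(xy) contains σ x and σ y.
-- If σ identified two vertices it would be constant, so f would map into a
-- single star, and the second endpoint of f(e) would be a proper colouring of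
-- the edges of K_n with n − 1 colours.  For odd n that is impossible: each
-- colour would then meet every vertex exactly once, pairing up the vertices.
-- So σ is a permutation and f is the automorphism it induces.

open import Defs
open import Algebra.Definitions using (Involutive)
open import Data.Empty using (⊥; ⊥-elim)
open import Data.Fin using (Fin; zero; suc; punchIn; punchOut)
open import Data.Fin.Properties
  using (_≟_; any?; <-cmp; <-irrelevant; <-asym; <-irrefl; <⇒≢; suc-injective;
         punchIn-injective; punchInᵢ≢i; punchIn-punchOut; punchOut-injective; injective⇒≤)
open import Data.Nat using (ℕ; suc; _+_; _*_; parity)
import Data.Nat.Properties as ℕ
open import Data.Parity.Base as ℙ using (0ℙ; 1ℙ)
open import Data.Parity.Properties using (+-homo-+; *-homo-*)
open import Data.Product using (∃; _×_; _,_; proj₁; proj₂)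
open import Data.Sum using (_⊎_; inj₁; inj₂; [_,_])
open import Function using (_∘_; id)
open import Function.Definitions using (Injective)
open import Relation.Binary.Definitions using (tri<; tri≈; tri>)
open import Relation.Binary.PropositionalEquality
  using (_≡_; _≢_; refl; sym; trans; cong; subst; module ≡-Reasoning)
open import Relation.Nullary using (¬_; yes; no; contradiction)

parity-2*n+1 : ∀ n → parity (2 * n + 1) ≡ 1ℙ
parity-2*n+1 n = trans (+-homo-+ (2 * n) 1) (cong (ℙ._+ 1ℙ) (*-homo-* 2 n))

injective⇒surjective : ∀ {n} {h : Fin n → Fin n} → Injective _≡_ _≡_ h →
                       ∀ y → ∃ λ x → h x ≡ y
injective⇒surjective {suc n} {h} h-inj y with any? (λ x → h x ≟ y)
... | yes hit = hit
... | no miss = contradiction (injective⇒≤ h-avoiding-y-injective) (ℕ.<-irrefl refl)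
  where
  h-avoiding-y : Fin (suc n) → Fin n
  h-avoiding-y x = punchOut {i = y} {j = h x} (λ y≡hx → miss (x , sym y≡hx))

  h-avoiding-y-injective : Injective _≡_ _≡_ h-avoiding-y
  h-avoiding-y-injective {x} {x′} = h-inj ∘ punchOut-injective {i = y} {j = h x} {k = h x′} _ _

FixedPointFree : ∀ {n} → (Fin n → Fin n) → Set
FixedPointFree π = ∀ i → π i ≢ i

-- Writing π 0 = suc t, the complement of the 2-cycle {0, suc t} is the image of
-- ι = suc ∘ punchIn t, and π restricts to it.
remove-2-cycle : ∀ {n} (π : Fin (suc (suc n)) → Fin (suc (suc n))) →
                 Involutive _≡_ π → FixedPointFree π →
                 ∃ λ (ρ : Fin n → Fin n) → Involutive _≡_ ρ × FixedPointFree ρ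
remove-2-cycle π π-inv π-fpf with π zero in π0≡t
... | zero  = ⊥-elim (π-fpf zero π0≡t)
... | suc t = ρ , ρ-involutive , ρ-fixedPointFree
  where
  ι : Fin _ → Fin _
  ι i = suc (punchIn t i)

  ι-injective : Injective _≡_ _≡_ ι
  ι-injective = punchIn-injective t _ _ ∘ suc-injective

  π-injective : Injective _≡_ _≡_ π
  π-injective {x} {y} πx≡πy = trans (sym (π-inv x)) (trans (cong π πx≡πy) (π-inv y))

  π∘ι≢zero : ∀ i → π (ι i) ≢ zero
  π∘ι≢zero i πιi≡0 = punchInᵢ≢i t i (suc-injective (π-injective (begin
    π (ι i)        ≡⟨ πιi≡0 ⟩
    zero           ≡⟨ sym (π-inv zero) ⟩
    π (π zero)     ≡⟨ cong π π0≡t ⟩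
    π (suc t)      ∎)))
    where open ≡-Reasoning

  π∘ι≢suc-t : ∀ i → π (ι i) ≢ suc t
  π∘ι≢suc-t i πιi≡t with π-injective (trans πιi≡t (sym π0≡t))
  ... | ()

  ι-preimage : ∀ x → x ≢ zero → x ≢ suc t → ∃ λ i → ι i ≡ x
  ι-preimage zero    x≢0 _   = ⊥-elim (x≢0 refl)
  ι-preimage (suc x) _   x≢t =
    punchOut (x≢t ∘ cong suc ∘ sym) , cong suc (punchIn-punchOut (x≢t ∘ cong suc ∘ sym))

  ρ : Fin _ → Fin _
  ρ i = proj₁ (ι-preimage (π (ι i)) (π∘ι≢zero i) (π∘ι≢suc-t i))

  ι∘ρ≡π∘ι : ∀ i → ι (ρ i) ≡ π (ι i)
  ι∘ρ≡π∘ι i = proj₂ (ι-preimage (π (ι i)) (π∘ι≢zero i) (π∘ι≢suc-t i))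

  ρ-involutive : Involutive _≡_ ρ
  ρ-involutive i = ι-injective (begin
    ι (ρ (ρ i))    ≡⟨ ι∘ρ≡π∘ι (ρ i) ⟩
    π (ι (ρ i))    ≡⟨ cong π (ι∘ρ≡π∘ι i) ⟩
    π (π (ι i))    ≡⟨ π-inv (ι i) ⟩
    ι i            ∎)
    where open ≡-Reasoning

  ρ-fixedPointFree : FixedPointFree ρ
  ρ-fixedPointFree i ρi≡i = π-fpf (ι i) (trans (sym (ι∘ρ≡π∘ι i)) (cong ι ρi≡i))

fixedPointFree-involution⇒even : ∀ n (π : Fin n → Fin n) →
                                 Involutive _≡_ π → FixedPointFree π → parity n ≡ 0ℙ
fixedPointFree-involution⇒even 0 _ _ _ = refl
fixedPointFree-involution⇒even 1 π _ π-fpf with π zero in π0≡0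
... | zero = ⊥-elim (π-fpf zero π0≡0)
fixedPointFree-involution⇒even (suc (suc n)) π π-inv π-fpf
  with ρ , ρ-inv , ρ-fpf ← remove-2-cycle π π-inv π-fpf
  = fixedPointFree-involution⇒even n ρ ρ-inv ρ-fpf

infix 4 _∈ₑ_ _∼_

_∈ₑ_ : ∀ {n} → Fin n → Edge n → Set
x ∈ₑ ((i , j) , _) = x ≡ i ⊎ x ≡ j

_∼_ : ∀ {n} → Edge n → Edge n → Set
_∼_ {n} = Adj (LineGraphOfComplete n)

∈ₑ-at-most-two : ∀ {n} {x y z : Fin n} {e : Edge n} →
                 x ≢ y → x ∈ₑ e → y ∈ₑ e → z ∈ₑ e → z ≡ x ⊎ z ≡ y
∈ₑ-at-most-two x≢y (inj₁ refl) (inj₁ refl) _          = ⊥-elim (x≢y refl)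
∈ₑ-at-most-two x≢y (inj₂ refl) (inj₂ refl) _          = ⊥-elim (x≢y refl)
∈ₑ-at-most-two _   (inj₁ refl) (inj₂ refl) (inj₁ refl) = inj₁ refl
∈ₑ-at-most-two _   (inj₁ refl) (inj₂ refl) (inj₂ refl) = inj₂ refl
∈ₑ-at-most-two _   (inj₂ refl) (inj₁ refl) (inj₁ refl) = inj₂ refl
∈ₑ-at-most-two _   (inj₂ refl) (inj₁ refl) (inj₂ refl) = inj₁ refl

⊆ₑ⇒≡ : ∀ {n} {e e′ : Edge n} → (∀ {z} → z ∈ₑ e → z ∈ₑ e′) → e ≡ e′
⊆ₑ⇒≡ {e = (i , j) , i<j} {(k , l) , k<l} e⊆e′ with e⊆e′ (inj₁ refl) | e⊆e′ (inj₂ refl)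
... | inj₁ refl | inj₂ refl = cong ((i , j) ,_) (<-irrelevant i<j k<l)
... | inj₂ refl | inj₁ refl = ⊥-elim (<-asym i<j k<l)
... | inj₁ refl | inj₁ refl = ⊥-elim (<-irrefl refl i<j)
... | inj₂ refl | inj₂ refl = ⊥-elim (<-irrefl refl i<j)

endpoints⇒≡ : ∀ {n} {x y : Fin n} {e e′ : Edge n} →
              x ≢ y → x ∈ₑ e → y ∈ₑ e → x ∈ₑ e′ → y ∈ₑ e′ → e ≡ e′
endpoints⇒≡ {e = e} x≢y x∈e y∈e x∈e′ y∈e′ = ⊆ₑ⇒≡ λ z∈e →
  [ (λ { refl → x∈e′ }) , (λ { refl → y∈e′ }) ] (∈ₑ-at-most-two {e = e} x≢y x∈e y∈e z∈e)

other-endpoint : ∀ {n} {z : Fin n} (e : Edge n) → z ∈ₑ e → ∃ λ w → w ∈ₑ e × w ≢ z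
other-endpoint ((i , j) , i<j) (inj₁ refl) = j , inj₂ refl , <⇒≢ i<j ∘ sym
other-endpoint ((i , j) , i<j) (inj₂ refl) = i , inj₁ refl , <⇒≢ i<j

common-endpoint : ∀ {n} {e e′ : Edge n} → e ∼ e′ → ∃ λ x → x ∈ₑ e × x ∈ₑ e′
common-endpoint (_ , inj₁ refl)               = _ , inj₁ refl , inj₁ refl
common-endpoint (_ , inj₂ (inj₁ refl))        = _ , inj₁ refl , inj₂ refl
common-endpoint (_ , inj₂ (inj₂ (inj₁ refl))) = _ , inj₂ refl , inj₁ refl
common-endpoint (_ , inj₂ (inj₂ (inj₂ refl))) = _ , inj₂ refl , inj₂ refl

meeting⇒∼ : ∀ {n} {x : Fin n} {e e′ : Edge n} → e ≢ e′ → x ∈ₑ e → x ∈ₑ e′ → e ∼ e′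
meeting⇒∼ e≢e′ (inj₁ refl) (inj₁ refl) = e≢e′ , inj₁ refl
meeting⇒∼ e≢e′ (inj₁ refl) (inj₂ refl) = e≢e′ , inj₂ (inj₁ refl)
meeting⇒∼ e≢e′ (inj₂ refl) (inj₁ refl) = e≢e′ , inj₂ (inj₂ (inj₁ refl))
meeting⇒∼ e≢e′ (inj₂ refl) (inj₂ refl) = e≢e′ , inj₂ (inj₂ (inj₂ refl))

edge : ∀ {n} (x y : Fin n) → x ≢ y → Edge n
edge x y x≢y with <-cmp x y
... | tri< x<y _ _ = (x , y) , x<y
... | tri≈ _ x≡y _ = ⊥-elim (x≢y x≡y)
... | tri> _ _ y<x = (y , x) , y<x

∈-edgeˡ : ∀ {n} {x y : Fin n} (x≢y : x ≢ y) → x ∈ₑ edge x y x≢y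
∈-edgeˡ {x = x} {y} x≢y with <-cmp x y
... | tri< _ _ _   = inj₁ refl
... | tri≈ _ x≡y _ = ⊥-elim (x≢y x≡y)
... | tri> _ _ _   = inj₂ refl

∈-edgeʳ : ∀ {n} {x y : Fin n} (x≢y : x ≢ y) → y ∈ₑ edge x y x≢y
∈-edgeʳ {x = x} {y} x≢y with <-cmp x y
... | tri< _ _ _   = inj₂ refl
... | tri≈ _ x≡y _ = ⊥-elim (x≢y x≡y)
... | tri> _ _ _   = inj₁ refl

∈-edge⁻¹ : ∀ {n} {x y z : Fin n} (x≢y : x ≢ y) → z ∈ₑ edge x y x≢y → z ≡ x ⊎ z ≡ y
∈-edge⁻¹ {x = x} {y} x≢y = ∈ₑ-at-most-two {e = edge x y x≢y} x≢y (∈-edgeˡ x≢y) (∈-edgeʳ x≢y)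

4-clique⇒star : ∀ {n} {z : Fin n} {e₁ e₂ e₃ e₄ : Edge n} →
                e₁ ≢ e₂ → z ∈ₑ e₁ → z ∈ₑ e₂ →
                e₃ ∼ e₁ → e₃ ∼ e₂ → e₄ ∼ e₁ → e₄ ∼ e₂ → e₄ ∼ e₃ → z ∈ₑ e₃
4-clique⇒star {z = z} {e₁} {e₂} {e₃} e₁≢e₂ z∈e₁ z∈e₂ e₃∼e₁ e₃∼e₂ e₄∼e₁ e₄∼e₂ e₄∼e₃
  with common-endpoint e₃∼e₁ | common-endpoint e₃∼e₂
... | p , p∈e₃ , p∈e₁ | q , q∈e₃ , q∈e₂ with z ≟ p | z ≟ q
...   | yes refl | _        = p∈e₃
...   | no _     | yes refl = q∈e₃
...   | no z≢p   | no z≢q   = ⊥-elim e₄-is-a-side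
  where
  p≢q : p ≢ q
  p≢q refl = e₁≢e₂ (endpoints⇒≡ z≢p z∈e₁ p∈e₁ z∈e₂ q∈e₂)

  -- e₃ = {p, q}, so the sides of the triangle are {z, p}, {z, q}, {p, q}.
  e₄-is-a-side : ⊥
  e₄-is-a-side with common-endpoint e₄∼e₁ | common-endpoint e₄∼e₂ | common-endpoint e₄∼e₃
  ... | r , r∈e₄ , r∈e₁ | s , s∈e₄ , s∈e₂ | t , t∈e₄ , t∈e₃
    with ∈ₑ-at-most-two {e = e₁} z≢p z∈e₁ p∈e₁ r∈e₁
       | ∈ₑ-at-most-two {e = e₂} z≢q z∈e₂ q∈e₂ s∈e₂
       | ∈ₑ-at-most-two {e = e₃} p≢q p∈e₃ q∈e₃ t∈e₃
  ... | inj₁ refl | _         | inj₁ refl = proj₁ e₄∼e₁ (endpoints⇒≡ z≢p r∈e₄ t∈e₄ z∈e₁ p∈e₁)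
  ... | inj₁ refl | _         | inj₂ refl = proj₁ e₄∼e₂ (endpoints⇒≡ z≢q r∈e₄ t∈e₄ z∈e₂ q∈e₂)
  ... | inj₂ refl | inj₁ refl | _         = proj₁ e₄∼e₁ (endpoints⇒≡ z≢p s∈e₄ r∈e₄ z∈e₁ p∈e₁)
  ... | inj₂ refl | inj₂ refl | _         = proj₁ e₄∼e₃ (endpoints⇒≡ p≢q r∈e₄ s∈e₄ p∈e₃ q∈e₃)

spoke : ∀ {n} (v : Fin (suc n)) → Fin n → Edge (suc n)
spoke v j = edge v (punchIn v j) (punchInᵢ≢i v j ∘ sym)

centre∈spoke : ∀ {n} (v : Fin (suc n)) j → v ∈ₑ spoke v j
centre∈spoke v j = ∈-edgeˡ (punchInᵢ≢i v j ∘ sym)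

end∈spoke : ∀ {n} (v : Fin (suc n)) j → punchIn v j ∈ₑ spoke v j
end∈spoke v j = ∈-edgeʳ (punchInᵢ≢i v j ∘ sym)

∈-spoke⁻¹ : ∀ {n} {v z : Fin (suc n)} {j} → z ∈ₑ spoke v j → z ≡ v ⊎ z ≡ punchIn v j
∈-spoke⁻¹ {v = v} {j = j} = ∈-edge⁻¹ (punchInᵢ≢i v j ∘ sym)

spokes-adjacent : ∀ {n} (v : Fin (suc n)) {j j′} → j ≢ j′ → spoke v j ∼ spoke v j′
spokes-adjacent v {j} {j′} j≢j′ = meeting⇒∼ spoke-j≢spoke-j′ (centre∈spoke v j) (centre∈spoke v j′)
  where
  spoke-j≢spoke-j′ : spoke v j ≢ spoke v j′
  spoke-j≢spoke-j′ eq with ∈-spoke⁻¹ (subst (punchIn v j′ ∈ₑ_) (sym eq) (end∈spoke v j′))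
  ... | inj₁ j′-at-σ = punchInᵢ≢i v j′ j′-at-σ
  ... | inj₂ j′-at-end    = j≢j′ (sym (punchIn-injective v j′ j j′-at-end))

edge-through⇒spoke : ∀ {n} {v : Fin (suc n)} {e} → v ∈ₑ e → ∃ λ j → spoke v j ≡ e
edge-through⇒spoke {v = v} {e} v∈e with other-endpoint e v∈e
... | w , w∈e , w≢v = j , endpoints⇒≡ (punchInᵢ≢i v j ∘ sym) (centre∈spoke v j) (end∈spoke v j) v∈e
                            (subst (_∈ₑ e) (sym (punchIn-punchOut (w≢v ∘ sym))) w∈e)
  where
  j : Fin _
  j = punchOut (w≢v ∘ sym)

ProperEdgeColouring : ∀ {n} {C : Set} → (Edge n → C) → Set
ProperEdgeColouring col = ∀ {e e′} → e ∼ e′ → col e ≢ col e′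

-- The n edges at a vertex v get n distinct colours, so colour c occurs at v exactly
-- once, on the edge to partner v; thus partner pairs up the odd number of vertices.
no-proper-edge-colouring : ∀ {n} → parity (suc n) ≡ 1ℙ →
                           (col : Edge (suc n) → Fin n) → ProperEdgeColouring col → ¬ Fin n
no-proper-edge-colouring {n} odd col proper c =
  contradiction (trans (sym (fixedPointFree-involution⇒even (suc n) partner
                               partner-involutive partner-fixedPointFree)) odd) λ ()
  where
  spoke-colour-injective : ∀ v → Injective _≡_ _≡_ (col ∘ spoke v)
  spoke-colour-injective v {j} {j′} same-colour with j ≟ j′
  ... | yes j≡j′ = j≡j′
  ... | no j≢j′  = contradiction same-colour (proper (spokes-adjacent v j≢j′))

  partner-index : Fin (suc n) → Fin n
  partner-index v = proj₁ (injective⇒surjective (spoke-colour-injective v) c)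

  c-spoke : Fin (suc n) → Edge (suc n)
  c-spoke v = spoke v (partner-index v)

  c-spoke-colour : ∀ v → col (c-spoke v) ≡ c
  c-spoke-colour v = proj₂ (injective⇒surjective (spoke-colour-injective v) c)

  partner : Fin (suc n) → Fin (suc n)
  partner v = punchIn v (partner-index v)

  partner-fixedPointFree : FixedPointFree partner
  partner-fixedPointFree v = punchInᵢ≢i v (partner-index v)

  partner-involutive : Involutive _≡_ partner
  partner-involutive v with partner (partner v) ≟ v
  ... | yes back = back
  ... | no ¬back = contradiction (trans (c-spoke-colour u) (sym (c-spoke-colour v)))
                     (proper (meeting⇒∼ c-spokes-differ (centre∈spoke u _) (end∈spoke v _)))
    where
    u : Fin (suc n)
    u = partner v

    c-spokes-differ : c-spoke u ≢ c-spoke v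
    c-spokes-differ eq with ∈-spoke⁻¹ (subst (v ∈ₑ_) (sym eq) (centre∈spoke v _))
    ... | inj₁ v≡u = partner-fixedPointFree v (sym v≡u)
    ... | inj₂ v≡partner-u = ¬back (sym v≡partner-u)

no-endomorphism-into-star : ∀ {n} → parity (suc (suc n)) ≡ 1ℙ →
                            ∀ {f} → IsEndomorphism (LineGraphOfComplete (suc (suc n))) f →
                            (w : Fin (suc (suc n))) → ¬ (∀ e → w ∈ₑ f e)
no-endomorphism-into-star odd {f} endo w w∈f =
  no-proper-edge-colouring odd far-end far-end-proper zero
  where
  far : ∀ e → ∃ λ x → x ∈ₑ f e × x ≢ w
  far e = other-endpoint (f e) (w∈f e)

  far-end : Edge _ → Fin _
  far-end e = punchOut (proj₂ (proj₂ (far e)) ∘ sym)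

  far-end-proper : ProperEdgeColouring far-end
  far-end-proper {e} {e′} e∼e′ same-colour = proj₁ (endo e∼e′)
    (endpoints⇒≡ (x≢w ∘ sym) (w∈f e) x∈fe (w∈f e′) (subst (_∈ₑ f e′) (sym x≡x′) x′∈fe′))
    where
    x : Fin _
    x = proj₁ (far e)

    x∈fe : x ∈ₑ f e
    x∈fe = proj₁ (proj₂ (far e))

    x≢w : x ≢ w
    x≢w = proj₂ (proj₂ (far e))

    x′∈fe′ : proj₁ (far e′) ∈ₑ f e′
    x′∈fe′ = proj₁ (proj₂ (far e′))

    x≡x′ : x ≡ proj₁ (far e′)
    x≡x′ = punchOut-injective {i = w} _ _ same-colour

mapEdge : ∀ {n} (h : Fin n → Fin n) → Injective _≡_ _≡_ h → Edge n → Edge n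
mapEdge h h-inj ((i , j) , i<j) = edge (h i) (h j) (<⇒≢ i<j ∘ h-inj)

∈-mapEdge : ∀ {n} {h : Fin n → Fin n} (h-inj : Injective _≡_ _≡_ h) {z} e →
            z ∈ₑ e → h z ∈ₑ mapEdge h h-inj e
∈-mapEdge h-inj ((i , j) , i<j) (inj₁ refl) = ∈-edgeˡ (<⇒≢ i<j ∘ h-inj)
∈-mapEdge h-inj ((i , j) , i<j) (inj₂ refl) = ∈-edgeʳ (<⇒≢ i<j ∘ h-inj)

induced-automorphism : ∀ {n} {f : Edge n → Edge n} → IsEndomorphism (LineGraphOfComplete n) f →
                       (σ : Fin n → Fin n) → Injective _≡_ _≡_ σ →
                       (∀ {z e} → z ∈ₑ e → σ z ∈ₑ f e) →
                       IsAutomorphism (LineGraphOfComplete n) f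
induced-automorphism {f = f} endo σ σ-inj σ∈f = g , g∘f≗id , f∘g≗id , endo , g-endo
  where
  σ⁻¹ : Fin _ → Fin _
  σ⁻¹ y = proj₁ (injective⇒surjective σ-inj y)

  σ∘σ⁻¹≗id : ∀ y → σ (σ⁻¹ y) ≡ y
  σ∘σ⁻¹≗id y = proj₂ (injective⇒surjective σ-inj y)

  σ⁻¹∘σ≗id : ∀ x → σ⁻¹ (σ x) ≡ x
  σ⁻¹∘σ≗id x = σ-inj (σ∘σ⁻¹≗id (σ x))

  σ⁻¹-injective : Injective _≡_ _≡_ σ⁻¹
  σ⁻¹-injective {y} {y′} eq = trans (sym (σ∘σ⁻¹≗id y)) (trans (cong σ eq) (σ∘σ⁻¹≗id y′))

  g : Edge _ → Edge _
  g = mapEdge σ⁻¹ σ⁻¹-injective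

  g∘f≗id : ∀ e → g (f e) ≡ e
  g∘f≗id e = sym (⊆ₑ⇒≡ λ {z} z∈e →
    subst (_∈ₑ g (f e)) (σ⁻¹∘σ≗id z) (∈-mapEdge σ⁻¹-injective (f e) (σ∈f z∈e)))

  f∘g≗id : ∀ e → f (g e) ≡ e
  f∘g≗id e = sym (⊆ₑ⇒≡ λ {z} z∈e →
    subst (_∈ₑ f (g e)) (σ∘σ⁻¹≗id z) (σ∈f (∈-mapEdge σ⁻¹-injective e z∈e)))

  g-endo : IsEndomorphism (LineGraphOfComplete _) g
  g-endo {e} {e′} e∼e′ with common-endpoint e∼e′
  ... | x , x∈e , x∈e′ =
    meeting⇒∼ ge≢ge′ (∈-mapEdge σ⁻¹-injective e x∈e) (∈-mapEdge σ⁻¹-injective e′ x∈e′)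
    where
    ge≢ge′ : g e ≢ g e′
    ge≢ge′ eq = proj₁ e∼e′ (trans (sym (f∘g≗id e)) (trans (cong f eq) (f∘g≗id e′)))

other-element : ∀ {k} → k ≢ 1 → (i : Fin k) → ∃ λ i′ → i′ ≢ i
other-element {1}           k≢1 _       = ⊥-elim (k≢1 refl)
other-element {suc (suc _)} _   zero    = suc zero , λ ()
other-element {suc (suc _)} _   (suc _) = zero , λ ()

odd⇒≢4 : ∀ {n} → parity n ≡ 1ℙ → n ≢ 4
odd⇒≢4 () refl

module _ {k : ℕ} {f : Edge (3 + k) → Edge (3 + k)}
         (endo : IsEndomorphism (LineGraphOfComplete (3 + k)) f) where

  private
    f-spokes-adjacent : ∀ v {j j′} → j ≢ j′ → f (spoke v j) ∼ f (spoke v j′)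
    f-spokes-adjacent v = endo ∘ spokes-adjacent v

    f-spokes-0-1-meet : ∀ v → ∃ λ x → x ∈ₑ f (spoke v zero) × x ∈ₑ f (spoke v (suc zero))
    f-spokes-0-1-meet v = common-endpoint (f-spokes-adjacent v {zero} {suc zero} λ ())

  σ : Fin (3 + k) → Fin (3 + k)
  σ v = proj₁ (f-spokes-0-1-meet v)

  σ∈f-spoke : 3 + k ≢ 4 → ∀ v j → σ v ∈ₑ f (spoke v j)
  σ∈f-spoke _   v zero          = proj₁ (proj₂ (f-spokes-0-1-meet v))
  σ∈f-spoke _   v (suc zero)    = proj₂ (proj₂ (f-spokes-0-1-meet v))
  σ∈f-spoke n≢4 v (suc (suc i)) with i′ , i′≢i ← other-element (n≢4 ∘ cong (3 +_)) i =
    4-clique⇒star (proj₁ (f-spokes-adjacent v {zero} {suc zero} λ ()))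
      (σ∈f-spoke n≢4 v zero) (σ∈f-spoke n≢4 v (suc zero))
      (f-spokes-adjacent v λ ()) (f-spokes-adjacent v λ ())
      (f-spokes-adjacent v λ ()) (f-spokes-adjacent v λ ())
      (f-spokes-adjacent v (i′≢i ∘ suc-injective ∘ suc-injective))

  σ∈f : 3 + k ≢ 4 → ∀ {z e} → z ∈ₑ e → σ z ∈ₑ f e
  σ∈f n≢4 {z} z∈e with j , spoke≡e ← edge-through⇒spoke z∈e =
    subst (λ e → σ z ∈ₑ f e) spoke≡e (σ∈f-spoke n≢4 z j)

  σ-injective : parity (3 + k) ≡ 1ℙ → Injective _≡_ _≡_ σ
  σ-injective odd {u} {v} σu≡σv with u ≟ v
  ... | yes u≡v = u≡v
  ... | no u≢v  = ⊥-elim (no-endomorphism-into-star odd endo (σ u) σ-u∈f)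
    where
    σ∈f′ : ∀ {z e} → z ∈ₑ e → σ z ∈ₑ f e
    σ∈f′ = σ∈f (odd⇒≢4 odd)

    -- Otherwise the distinct adjacent images f(xu) and f(xv) would share both σ x ≠ σ u.
    σ-constant : ∀ x → σ x ≡ σ u
    σ-constant x with σ x ≟ σ u
    ... | yes σx≡σu = σx≡σu
    ... | no σx≢σu  = ⊥-elim (proj₁ (endo xu∼xv) (endpoints⇒≡ σx≢σu
          (σ∈f′ (∈-edgeˡ x≢u)) (σ∈f′ (∈-edgeʳ x≢u))
          (σ∈f′ (∈-edgeˡ x≢v)) (subst (_∈ₑ f (edge x v x≢v)) (sym σu≡σv) (σ∈f′ (∈-edgeʳ x≢v)))))
      where
      x≢u : x ≢ u
      x≢u = σx≢σu ∘ cong σ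

      x≢v : x ≢ v
      x≢v x≡v = σx≢σu (trans (cong σ x≡v) (sym σu≡σv))

      xu∼xv : edge x u x≢u ∼ edge x v x≢v
      xu∼xv = meeting⇒∼ (λ eq → [ x≢u ∘ sym , u≢v ] (∈-edge⁻¹ x≢v (subst (u ∈ₑ_) eq (∈-edgeʳ x≢u))))
                (∈-edgeˡ x≢u) (∈-edgeˡ x≢v)

    σ-u∈f : ∀ e → σ u ∈ₑ f e
    σ-u∈f e@((i , _) , _) = subst (_∈ₑ f e) (σ-constant i) (σ∈f′ (inj₁ refl))

lineGraphOfComplete-isCore : ∀ n → parity n ≡ 1ℙ → IsCore (LineGraphOfComplete n)
lineGraphOfComplete-isCore 0 ()
lineGraphOfComplete-isCore 1 _ f endo =
  induced-automorphism endo id id λ {_} {e} _ → ⊥-elim (no-edge e)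
  where
  no-edge : ¬ Edge 1
  no-edge ((zero , zero) , ())
lineGraphOfComplete-isCore 2 ()
lineGraphOfComplete-isCore (suc (suc (suc k))) odd f endo =
  induced-automorphism endo (σ endo) (σ-injective endo odd) (σ∈f endo (odd⇒≢4 odd))

mainTheorem7 : (m : ℕ) → IsCore (LineGraphOfComplete (2 * suc m + 1))
mainTheorem7 m = lineGraphOfComplete-isCore (2 * suc m + 1) (parity-2*n+1 (suc m))
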